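{- Let $\mathbf{O}$ be an appropriate class of continuous operators such that the functions $\check{c}$ for all $c\in\mathbb{N}$ and the functions $\mu_{k,c}$ for all $k,c\in\mathbb{N}$ are $\mathbf{O}$-representable. Let $\mathbf{M}=(M,d,A,\alpha)$ and $\mathbf{M'}=(M',d',A',\alpha')$ be effective metric spaces with $\mathrm{dom}(\alpha),\mathrm{dom}(\alpha')\subseteq\mathbb{N}$. Then every conditionally $\mathbf{O}$-computable partial function from $\mathbf{M}$ to $\mathbf{M'}$ is locally uniformly $\mathbf{O}$-computable.
   Context: $\mathbb{T}_m$ is the set of total functions $\mathbb{N}^m\to\mathbb{N}$; a $k$-ary operator is a map $\mathbb{T}_1^k\to\mathbb{T}_1$; $\check{c}\in\mathbb{T}_1$ is the constant function with value $c$. An operator $F$ is continuous if for all $f_1,\ldots,f_k\in\mathbb{T}_1$ and $n$ there is $u$ such that $F(g_1,\ldots,g_k)(n)=F(f_1,\ldots,f_k)(n)$ whenever each $g_i$ agrees with $f_i$ on all $t\le u$. A class $\mathbf{O}$ of operators is appropriate if: (1) for all $k$ and $i\le k$ the operator $(f_1,\ldots,f_k)\mapsto f_i$ is in $\mathbf{O}$; (2) the operator $F(f_1,f_2)(n)=f_1(f_2(n))$ is in $\mathbf{O}$; (3) if $F$ is $k$-ary in $\mathbf{O}$ and $G_1,\ldots,G_k$ are $l$-ary in $\mathbf{O}$, then $H(g_1,\ldots,g_l)=F(G_1(g_1,\ldots,g_l),\ldots,G_k(g_1,\ldots,g_l))$ is in $\mathbf{O}$; (4) if $F$ is $(k+1)$-ary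 in $\mathbf{O}$, then $G(f_1,\ldots,f_k)(n)=F(f_1,\ldots,f_k,\check{n})(n)$ is in $\mathbf{O}$. For $f:\mathbb{N}^k\to\mathbb{N}$, $\mathring{f}(f_1,\ldots,f_k)(n)=f(f_1(n),\ldots,f_k(n))$; $f$ is $\mathbf{O}$-representable if $\mathring{f}\in\mathbf{O}$. $\mu_{k,c}(x,y)=c$ if $x=k$, and $y$ otherwise. An effective metric space $(M,d,A,\alpha)$ (Weihrauch, Def. 8.1.2) consists of a metric space $(M,d)$, a dense subset $A\subseteq M$ and a notation $\alpha$ of $A$ (surjective partial map onto $A$), here with $\mathrm{dom}(\alpha)\subseteq\mathbb{N}$. An ordinary name of $\xi\in M$ is $f\in\mathbb{T}_1$ with $f(t)\in\mathrm{dom}(\alpha)$ and $d(\alpha(f(t)),\xi)<\frac{1}{t+1}$ for all $t$. A partial function $\theta:D\to M'$, $D\subseteq M$, is uniformly $\mathbf{O}$-computable if there is a unary $T\in\mathbf{O}$ such that whenever $\xi\in D$ and $f$ is an ordinary name of $\xi$, $T(f)$ is an ordinary name of $\theta(\xi)$; it is conditionally $\mathbf{O}$-computable if there exist a unary $E\in\mathbf{O}$ and a binary $T\in\mathbf{O}$ such that whenever $\xi\in D$ and $f$ is an ordinary name of $\xi$, there is $s$ with $E(f)(s)=0$, and $T(f,\check s)$ is an ordinary name of $\theta(\xi)$ for every such $s$; it is locally uniformly $\mathbf{O}$-computable if every point of $D$ has a neighbourhood $U$ in $M$ such that the restriction of $\theta$ to $D\cap U$ is uniformly $\mathbf{O}$-computable.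 -}

module Defs where

open import Data.Nat using (ℕ; zero; suc; _≤_; _≡ᵇ_)
open import Data.Bool using (if_then_else_)
open import Data.Fin using (Fin; zero; suc)
open import Data.Integer using (+_)
open import Data.Rational using (ℚ; _/_; _<_; _+_; 0ℚ) renaming (_≤_ to _≤ℚ_)
open import Data.Product using (Σ; ∃; _×_; _,_)
open import Relation.Binary.PropositionalEquality using (_≡_)

T₁ : Set
T₁ = ℕ → ℕ

Op : ℕ → Set
Op k = (Fin k → T₁) → T₁

check : ℕ → T₁
check c _ = c

snoc : ∀ {k} {A : Set} → (Fin k → A) → A → Fin (suc k) → A
snoc {zero}  fs a zero    = a
snoc {suc k} fs a zero    = fs zero
snoc {suc k} fs a (suc i) = snoc (λ j → fs (suc j)) a i

Class : Set₁
Class = (k : ℕ) → Op k → Set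

Continuous : ∀ {k} → Op k → Set
Continuous {k} F = (fs : Fin k → T₁) (n : ℕ) →
  Σ ℕ λ u → (gs : Fin k → T₁) →
    ((i : Fin k) (t : ℕ) → t ≤ u → gs i t ≡ fs i t) → F gs n ≡ F fs n

ContinuousClass : Class → Set
ContinuousClass O = ∀ k (F : Op k) → O k F → Continuous F

record Appropriate (O : Class) : Set₁ where
  field
    proj : ∀ k (i : Fin k) → O k (λ fs → fs i)
    comp : O 2 (λ fs n → fs zero (fs (suc zero) n))
    subst : ∀ k l (F : Op k) (G : Fin k → Op l) → O k F → (∀ i → O l (G i)) →
      O l (λ gs → F (λ i → G i gs))
    diag : ∀ k (F : Op (suc k)) → O (suc k) F →
      O k (λ fs n → F (snoc fs (check n)) n)

ring : ∀ {k} → ((Fin k → ℕ) → ℕ) → Op k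
ring f fs n = f (λ i → fs i n)

Representable : Class → ∀ k → ((Fin k → ℕ) → ℕ) → Set
Representable O k f = O k (ring f)

μ : ℕ → ℕ → ℕ → ℕ → ℕ
μ k c x y = if x ≡ᵇ k then c else y

app1 : Op 1 → T₁ → T₁
app1 T f = T (λ _ → f)

app2 : Op 2 → T₁ → T₁ → T₁
app2 T f g = T (snoc (λ _ → f) g)

-- Metric spaces without real numbers: the real distance d(x,y) is encoded
-- by its (strict) upper rational cut  Lt x y q  :⇔  d(x,y) < q.

oneOver : ℕ → ℚ
oneOver t = + 1 / suc t

record EffMetricSpace : Set₁ where
  field
    M      : Set
    Lt     : M → M → ℚ → Set
    -- the cut is that of a nonnegative real number
    Lt-pos   : ∀ {x y q} → Lt x y q → 0ℚ < q
    Lt-up    : ∀ {x y q r} → Lt x y q → q ≤ℚ r → Lt x y r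
    Lt-round : ∀ {x y q} → Lt x y q → Σ ℚ λ r → r < q × Lt x y r
    Lt-inh   : ∀ x y → Σ ℚ λ q → Lt x y q
    Lt-zero  : ∀ x {q} → 0ℚ < q → Lt x x q
    Lt-sep   : ∀ {x y} → (∀ q → 0ℚ < q → Lt x y q) → x ≡ y
    Lt-sym   : ∀ {x y q} → Lt x y q → Lt y x q
    Lt-tri   : ∀ {x y z q r} → Lt x y q → Lt y z r → Lt x z (q + r)
    -- notation α : ⊆ ℕ → A of the dense subset A = range α
    dom    : ℕ → Set
    α      : (n : ℕ) → dom n → M
    dense  : ∀ x q → 0ℚ < q → Σ ℕ λ n → Σ (dom n) λ p → Lt (α n p) x q

open EffMetricSpace public

Name : (S : EffMetricSpace) → T₁ → M S → Set
Name S f ξ = (t : ℕ) → Σ (dom S (f t)) λ p → Lt S (α S (f t) p) ξ (oneOver t)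

Nbhd : (S : EffMetricSpace) → (M S → Set) → M S → Set
Nbhd S U ξ = Σ ℚ λ ε → 0ℚ < ε × (∀ y → Lt S y ξ ε → U y)

module _ (O : Class) (S S' : EffMetricSpace)
         (D : M S → Set) (θ : (x : M S) → D x → M S') where

  UniformlyComputable : Set
  UniformlyComputable = Σ (Op 1) λ T → O 1 T ×
    (∀ ξ (p : D ξ) f → Name S f ξ → Name S' (app1 T f) (θ ξ p))

  ConditionallyComputable : Set
  ConditionallyComputable = Σ (Op 1) λ E → Σ (Op 2) λ T → O 1 E × O 2 T ×
    (∀ ξ (p : D ξ) f → Name S f ξ →
       (Σ ℕ λ s → app1 E f s ≡ 0) ×
       (∀ s → app1 E f s ≡ 0 → Name S' (app2 T f (check s)) (θ ξ p)))

  LocallyUniformlyComputable : Set₁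
  LocallyUniformlyComputable = ∀ ξ → D ξ →
    Σ (M S → Set) λ U → Nbhd S U ξ ×
      Σ (Op 1) λ T → O 1 T ×
        (∀ η (p : D η) → U η → ∀ f → Name S f η → Name S' (app1 T f) (θ η p))

module Submission where

-- Fix ξ ∈ D and a *fast* name f of ξ (its t-th approximation lies within
-- 1/(2t+2) of ξ).  The conditional data yields s with E(f)(s) = 0, and
-- continuity of E yields u such that E(h)(s) = 0 for every h agreeing with
-- f up to u.  On the ball U of radius 1/(2u+2) around ξ we then compute
-- θ uniformly: given a name g of η ∈ U, the function h = overwrite (u+1) f g
-- (f below u+1, g from u+1 on) is again a name of η by the triangle
-- inequality, E(h)(s) = 0, so T(h, š) names θ(η).  The operator g ↦ T(h, š)
-- lies in O because overwriting finitely many values is an iteration of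
-- the representable functions μ_{k,c}.

open import Defs
open import Data.Nat as ℕ using (ℕ; zero; suc; _*_; _≤_; _<_; _≤?_; _≟_; s≤s)
import Data.Nat.Properties as ℕP
open import Data.Nat.Coprimality using (1-coprimeTo)
open import Data.Nat.Tactic.RingSolver using (solve-∀)
open import Data.Fin using (Fin; zero; suc)
open import Data.Integer using (+_; +≤+)
open import Data.Rational as ℚ using (ℚ; mkℚ; 0ℚ; _+_)
import Data.Rational.Properties as ℚP
open import Data.Rational.Unnormalised using (*≤*; *≡*)
import Data.Rational.Unnormalised.Properties as ℚᵘP
open import Data.Product using (Σ; _,_; proj₁; proj₂)
open import Relation.Nullary using (yes; no; contradiction)
open import Relation.Binary.PropositionalEquality
  using (_≡_; _≢_; refl; sym; trans; cong; subst)

-- oneOver n in normal form, so that its arithmetic can be computed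
oneOver≡mkℚ : ∀ n → oneOver n ≡ mkℚ (+ 1) n (1-coprimeTo (suc n))
oneOver≡mkℚ n = ℚP.normalize-coprime (1-coprimeTo (suc n))

oneOver-pos : ∀ n → 0ℚ ℚ.< oneOver n
oneOver-pos n = ℚP.positive⁻¹ (oneOver n) {{ℚP.normalize-pos 1 (suc n)}}

oneOver-antitone : ∀ {m n} → m ≤ n → oneOver n ℚ.≤ oneOver m
oneOver-antitone {m} {n} m≤n rewrite oneOver≡mkℚ m | oneOver≡mkℚ n =
  ℚP.toℚᵘ-cancel-≤ (*≤* (+≤+ (s≤s (ℕP.+-monoˡ-≤ 0 m≤n))))

oneOver-half : ∀ t → oneOver (suc (2 * t)) + oneOver (suc (2 * t)) ≡ oneOver t
oneOver-half t rewrite oneOver≡mkℚ t | oneOver≡mkℚ (suc (2 * t)) =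
  ℚP.toℚᵘ-injective (ℚᵘP.≃-trans (ℚP.toℚᵘ-homo-+ half half) (*≡* (cong +_ (cross t))))
  where
  half : ℚ
  half = mkℚ (+ 1) (suc (2 * t)) (1-coprimeTo _)
  -- cross-multiplied form of  1/d + 1/d = 2/d  with d = 2t+2
  cross : ∀ t → (1 * suc (suc (2 * t)) ℕ.+ 1 * suc (suc (2 * t))) * suc t
              ≡ 1 * (suc (suc (2 * t)) * suc (suc (2 * t)))
  cross = solve-∀

-- the error budget of a patched name: 1/(2t+2) + 1/(2u+2) ≤ 1/(t+1) for t ≤ u
oneOver-sum : ∀ {t u} → t ≤ u →
  oneOver (suc (2 * t)) + oneOver (suc (2 * u)) ℚ.≤ oneOver t
oneOver-sum {t} {u} t≤u = begin
  oneOver (suc (2 * t)) + oneOver (suc (2 * u))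
    ≤⟨ ℚP.+-monoʳ-≤ (oneOver (suc (2 * t)))
         (oneOver-antitone (s≤s (ℕP.*-monoʳ-≤ 2 t≤u))) ⟩
  oneOver (suc (2 * t)) + oneOver (suc (2 * t))
    ≡⟨ oneOver-half t ⟩
  oneOver t ∎
  where open ℚP.≤-Reasoning

μ-hit : ∀ k c y → μ k c k y ≡ c
μ-hit zero    c y = refl
μ-hit (suc k) c y = μ-hit k c y

μ-miss : ∀ {k x} c y → x ≢ k → μ k c x y ≡ y
μ-miss {zero}  {zero}  c y x≢k = contradiction refl x≢k
μ-miss {zero}  {suc x} c y x≢k = refl
μ-miss {suc k} {zero}  c y x≢k = refl
μ-miss {suc k} {suc x} c y x≢k = μ-miss c y (λ x≡k → x≢k (cong suc x≡k))

-- overwrite m f g agrees with f below m and with g from m on; it is built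
-- from g by m applications of μ, which is what makes it O-computable in g
overwrite : ℕ → T₁ → T₁ → T₁
overwrite zero    f g   = g
overwrite (suc m) f g n = μ m (f m) n (overwrite m f g n)

overwrite-below : ∀ m f g {n} → n < m → overwrite m f g n ≡ f n
overwrite-below (suc m) f g {n} n<1+m with n ≟ m
... | yes refl = μ-hit n (f n) _
... | no  n≢m  = trans (μ-miss (f m) _ n≢m)
                       (overwrite-below m f g (ℕP.≤∧≢⇒< (ℕP.≤-pred n<1+m) n≢m))

overwrite-above : ∀ m f g {n} → m ≤ n → overwrite m f g n ≡ g n
overwrite-above zero    f g m≤n = refl
overwrite-above (suc m) f g m<n =
  trans (μ-miss (f m) _ (ℕP.>⇒≢ m<n)) (overwrite-above m f g (ℕP.<⇒≤ m<n))

patchArgs : ℕ → T₁ → ℕ → Fin 2 → Op 1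
patchArgs m f s zero       = λ gs → overwrite m f (gs zero)
patchArgs m f s (suc zero) = ring (λ _ → s)

module _ {O : Class} (appropriate : Appropriate O)
         (const-rep : ∀ c → Representable O 1 (λ _ → c))
         (μ-rep : ∀ k c → Representable O 2 (λ xs → μ k c (xs zero) (xs (suc zero))))
  where
  open Appropriate appropriate renaming (subst to compose)

  identity-∈ : O 1 (λ _ n → n)
  identity-∈ = diag 1 _ (proj 2 (suc zero))

  overwrite-∈ : ∀ m f → O 1 (λ gs → overwrite m f (gs zero))
  overwrite-∈ zero    f = proj 1 zero
  overwrite-∈ (suc m) f = compose 2 1 _ args (μ-rep m (f m)) args-∈
    where
    args : Fin 2 → Op 1
    args zero       = λ _ n → n
    args (suc zero) = λ gs → overwrite m f (gs zero)
    args-∈ : ∀ i → O 1 (args i)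
    args-∈ zero       = identity-∈
    args-∈ (suc zero) = overwrite-∈ m f

  patched-∈ : ∀ {T} → O 2 T → ∀ m f s → O 1 (λ gs → T (λ i → patchArgs m f s i gs))
  patched-∈ {T} T-∈ m f s = compose 2 1 T (patchArgs m f s) T-∈ args-∈
    where
    args-∈ : ∀ i → O 1 (patchArgs m f s i)
    args-∈ zero       = overwrite-∈ m f
    args-∈ (suc zero) = const-rep s

continuous-ext : ∀ {k} {F : Op k} → Continuous F → ∀ fs gs →
  (∀ i t → gs i t ≡ fs i t) → ∀ n → F gs n ≡ F fs n
continuous-ext cont fs gs gs≗fs n = proj₂ (cont fs n) gs (λ i t _ → gs≗fs i t)

modulus : ∀ {F : Op 1} → Continuous F → T₁ → ℕ → ℕ
modulus cont f n = proj₁ (cont (λ _ → f) n)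

modulus-agree : ∀ {F : Op 1} (cont : Continuous F) f n g →
  (∀ t → t ≤ modulus cont f n → g t ≡ f t) → app1 F g n ≡ app1 F f n
modulus-agree cont f n g g≈f = proj₂ (cont (λ _ → f) n) (λ _ → g) (λ { zero → g≈f })

Approx : (S : EffMetricSpace) → M S → ℚ → ℕ → Set
Approx S ξ q n = Σ (dom S n) λ p → Lt S (α S n p) ξ q

Name-resp : ∀ S {f g ξ} → (∀ t → f t ≡ g t) → Name S f ξ → Name S g ξ
Name-resp S {ξ = ξ} f≗g f-name t = subst (Approx S ξ (oneOver t)) (f≗g t) (f-name t)

FastName : (S : EffMetricSpace) → T₁ → M S → Set
FastName S f ξ = ∀ t → Approx S ξ (oneOver (suc (2 * t))) (f t)

fastName-exists : ∀ S ξ → Σ T₁ λ f → FastName S f ξ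
fastName-exists S ξ = (λ t → proj₁ (approx t)) , (λ t → proj₂ (approx t))
  where
  approx : ∀ t → Σ ℕ (Approx S ξ (oneOver (suc (2 * t))))
  approx t = dense S ξ (oneOver (suc (2 * t))) (oneOver-pos (suc (2 * t)))

fast⇒name : ∀ S {f ξ} → FastName S f ξ → Name S f ξ
fast⇒name S fast t = proj₁ (fast t) , Lt-up S (proj₂ (fast t)) (oneOver-antitone t≤2t+1)
  where
  t≤2t+1 : t ≤ suc (2 * t)
  t≤2t+1 = ℕP.m≤n⇒m≤1+n (ℕP.m≤n*m t 2)

patched-name : ∀ S {f g ξ η} u → FastName S f ξ →
  Lt S η ξ (oneOver (suc (2 * u))) → Name S g η →
  Name S (overwrite (suc u) f g) η
patched-name S {f} {g} {ξ} {η} u fast η-close g-name t with t ≤? u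
... | yes t≤u = subst (Approx S η (oneOver t)) (sym (overwrite-below (suc u) f g (s≤s t≤u)))
                  (proj₁ (fast t) , Lt-up S (Lt-tri S (proj₂ (fast t)) (Lt-sym S η-close))
                                            (oneOver-sum t≤u))
... | no  t≰u = subst (Approx S η (oneOver t)) (sym (overwrite-above (suc u) f g (ℕP.≰⇒> t≰u)))
                  (g-name t)

theorem5 : (O : Class) → Appropriate O → ContinuousClass O →
    (∀ c → Representable O 1 (λ _ → c)) →
    (∀ k c → Representable O 2 (λ xs → μ k c (xs zero) (xs (suc zero)))) →
    (S S' : EffMetricSpace) (D : M S → Set) (θ : (x : M S) → D x → M S') →
    ConditionallyComputable O S S' D θ →
    LocallyUniformlyComputable O S S' D θ
theorem5 O appropriate continuous const-rep μ-rep S S' D θ (E , T , E-∈ , T-∈ , spec) ξ ξ∈D =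
  U , (oneOver (suc (2 * u)) , oneOver-pos (suc (2 * u)) , λ _ η∈U → η∈U) ,
  T-patched , patched-∈ appropriate const-rep μ-rep T-∈ (suc u) f s , T-patched-names
  where
  f : T₁
  f = proj₁ (fastName-exists S ξ)
  f-fast : FastName S f ξ
  f-fast = proj₂ (fastName-exists S ξ)
  E-cont : Continuous E
  E-cont = continuous 1 E E-∈
  s : ℕ
  s = proj₁ (proj₁ (spec ξ ξ∈D f (fast⇒name S f-fast)))
  u : ℕ
  u = modulus E-cont f s
  U : M S → Set
  U η = Lt S η ξ (oneOver (suc (2 * u)))
  T-patched : Op 1
  T-patched gs = T (λ i → patchArgs (suc u) f s i gs)
  -- h = overwrite (u+1) f g names η, and E(h)(s) = E(f)(s) = 0 since h agrees
  -- with f up to the modulus u; so T(h, š) names θ(η), and T-patched(g) = T(h, š)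
  T-patched-names : ∀ η (η∈D : D η) → U η → ∀ g → Name S g η → Name S' (app1 T-patched g) (θ η η∈D)
  T-patched-names η η∈D η∈U g g-name = Name-resp S' T-agrees (proj₂ (spec η η∈D h h-name) s Eh≡0)
    where
    h : T₁
    h = overwrite (suc u) f g
    h-name : Name S h η
    h-name = patched-name S u f-fast η∈U g-name
    Eh≡0 : app1 E h s ≡ 0
    Eh≡0 = trans (modulus-agree E-cont f s h (λ t t≤u → overwrite-below (suc u) f g (s≤s t≤u)))
                 (proj₂ (proj₁ (spec ξ ξ∈D f (fast⇒name S f-fast))))
    T-agrees : ∀ n → app2 T h (check s) n ≡ app1 T-patched g n
    T-agrees = continuous-ext (continuous 2 T T-∈) _ _ λ { zero _ → refl ; (suc zero) _ → refl }
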